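{- There exists a constant $c$ such that for all positive integers $n$ and $k\le n$ there exists a bipartite graph $E\subseteq L\times R$ with $\#L=2^n$, $\#R=2^k n^c$, in which every vertex of $L$ has at most $n^c$ neighbors in $R$, and for which on-line matching is possible up to size $2^k$.
   Context: On-line matching up to size $s$ in a bipartite graph $E\subseteq L\times R$ is the following game. An adversary presents pairwise distinct elements of $L$ one at a time, at most $s$ of them in total. Each time an element $x$ is presented, we must immediately and irrevocably assign to $x$ a neighbor $y\in R$ of $x$ (i.e., $(x,y)\in E$) that has not been assigned to any previously presented element. On-line matching is possible up to size $s$ if there is a strategy that succeeds in making such an assignment at every step, whatever the adversary's sequence of at most $s$ elements is. -}

module Defs where

open import Data.Nat using (ℕ; zero; suc)
open import Data.Fin using (Fin)
open import Data.Fin.Subset using (Subset; _∈_)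
open import Data.List using (List; []; _∷_; map)
open import Data.List.Membership.Propositional using () renaming (_∉_ to _∉ₗ_)
open import Data.Product using (Σ; _×_; _,_; proj₁; proj₂)
open import Data.Unit using (⊤)

-- A bipartite graph E ⊆ L × R with L = Fin a, R = Fin b, given by the
-- neighbourhood of each left vertex: y ∈ E x  iff  (x , y) ∈ E.
BipGraph : ℕ → ℕ → Set
BipGraph a b = Fin a → Subset b

-- Our side wins the on-line matching game of remaining length s from the
-- position M (the list of pairs (presented element, assigned neighbour) so far):
-- for every next element x not yet presented we can choose a neighbour y of x
-- not yet assigned, and then still win the game with s - 1 remaining steps.
-- The adversary may stop at any time (stopping is always fine for us), and
-- a (dependent) function producing the choices is exactly a strategy.
WinsFrom : ∀ {a b} → BipGraph a b → ℕ → List (Fin a × Fin b) → Set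
WinsFrom E zero    M = ⊤
WinsFrom E (suc s) M =
  (x : Fin _) → x ∉ₗ map proj₁ M →
  Σ (Fin _) λ y → (y ∈ E x) × (y ∉ₗ map proj₂ M) × WinsFrom E s ((x , y) ∷ M)

OnlineMatchable : ∀ {a b} → BipGraph a b → ℕ → Set
OnlineMatchable E s = WinsFrom E s []

-- Let N = 2^n, K = 2^k, B = 2^(k+2) and D = 2n+2. Averaging over all graphs
-- g : Fin N → Fin D → Fin B shows that the expected number of pairs (A, O) of
-- a set A of at most K left vertices and a list O of |A| - 1 right vertices
-- containing every neighbour of A is below 1, so some g satisfies Hall's
-- condition for all sets of at most K left vertices. The graph of the theorem
-- consists of k + 1 disjoint copies ("levels") of g; for n ≥ 2 its left degree
-- (k+1)(2n+2) is at most n^5 and its (k+1) 2^(k+2) right vertices fit into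
-- 2^k n^5 (n = 1 is done by hand).
-- The strategy matches each presented element to a free neighbour on the
-- lowest level that has one, so an element matched at level l has all its
-- neighbours on lower levels taken. If some presented x had all its neighbours
-- taken, then Hall's condition, applied on level m to x together with the
-- elements matched above level m, shows that at least as many elements are
-- matched at level m as above it, x included. Hence at least 2^(k+1) - 1
-- elements were matched before x, while fewer than K = 2^k are.

module Submission where

open import Defs
open import Data.Bool using (Bool; true; false; _∨_; _∧_; not; if_then_else_)
import Data.Bool.Properties as Boolₚ
open import Data.Empty using (⊥; ⊥-elim)
open import Data.Fin using (Fin; Fin′; zero; suc; toℕ; fromℕ<; inject; combine; remQuot; inject≤; _≟_)
open import Data.Fin.Properties using (all?; ¬∀⟶∃¬-smallest; ¬∀⟶∃¬)
import Data.Fin.Properties as Finₚ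
open import Data.Fin.Subset using (Subset; ∣_∣; ⁅_⁆; _∪_) renaming (_∈_ to _∈ₛ_; ⊥ to ∅)
open import Data.Fin.Subset.Properties using (x∈p∪q⁺; x∈⁅x⁆; ∣⁅x⁆∣≡1; ∣⊥∣≡0)
open import Data.List using (List; []; _∷_; length; map)
open import Data.List.Membership.Propositional using (_∈_; _∉_)
open import Data.List.Relation.Unary.All using (All; []; _∷_)
import Data.List.Relation.Unary.All as All
open import Data.List.Relation.Unary.AllPairs using ([]; _∷_)
open import Data.List.Relation.Unary.Any using (here; there)
open import Data.List.Relation.Unary.Unique.Propositional using (Unique)
open import Data.Nat using (ℕ; zero; suc; _+_; _*_; _^_; _≤_; _<_; z≤n; s≤s; z<s; s≤s⁻¹; _<?_; _≤?_; NonZero; >-nonZero⁻¹)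
open import Data.Nat.Properties hiding (_≟_)
open import Data.Nat.Properties using () renaming (_≟_ to _≟ℕ_)
open import Data.Nat.Tactic.RingSolver using (solve-∀)
open import Data.Product using (Σ; ∃; _×_; _,_; proj₁; proj₂)
open import Data.Sum using (inj₁; inj₂)
open import Data.Unit using (tt)
open import Data.Vec using (Vec; []; _∷_; lookup)
import Data.Vec as Vec
open import Function using (_∘_)
open import Relation.Binary.PropositionalEquality
open import Relation.Nullary using (yes; no; does; contradiction)

-- Finite sums

record Summation (A : Set) : Set where
  field
    ∑        : (A → ℕ) → ℕ
    ∑-cong   : ∀ {f g} → (∀ a → f a ≡ g a) → ∑ f ≡ ∑ g
    ∑-mono   : ∀ {f g} → (∀ a → f a ≤ g a) → ∑ f ≤ ∑ g
    ∑-+      : ∀ f g → ∑ (λ a → f a + g a) ≡ ∑ f + ∑ g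
    ∑-*ˡ     : ∀ c f → ∑ (λ a → c * f a) ≡ c * ∑ f
    ∑<∑⇒∃<  : ∀ f g → ∑ f < ∑ g → ∃ λ a → f a < g a
    ∑≡0⇒≡0  : ∀ f → ∑ f ≡ 0 → ∀ a → f a ≡ 0

  ∑-0 : ∑ (λ _ → 0) ≡ 0
  ∑-0 = ∑-*ˡ 0 (λ _ → 0)

  ∑-*ʳ : ∀ c f → ∑ (λ a → f a * c) ≡ ∑ f * c
  ∑-*ʳ c f = trans (∑-cong (λ a → *-comm (f a) c)) (trans (∑-*ˡ c f) (*-comm c _))

  size : ℕ
  size = ∑ (λ _ → 1)

  ∑-const : ∀ c → ∑ (λ _ → c) ≡ c * size
  ∑-const c = trans (∑-cong (λ _ → sym (*-identityʳ c))) (∑-*ˡ c (λ _ → 1))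

  ∑-*≤ : ∀ f c M → (∀ a → f a * c ≤ M) → ∑ f * c ≤ M * size
  ∑-*≤ f c M bound = begin
    ∑ f * c           ≡⟨ ∑-*ʳ c f ⟨
    ∑ (λ a → f a * c) ≤⟨ ∑-mono bound ⟩
    ∑ (λ _ → M)       ≡⟨ ∑-const M ⟩
    M * size          ∎
    where open ≤-Reasoning

open Summation public

sumFin : ∀ n → (Fin n → ℕ) → ℕ
sumFin zero    f = 0
sumFin (suc n) f = f zero + sumFin n (f ∘ suc)

finSummation : ∀ n → Summation (Fin n)
finSummation n = record
  { ∑ = sumFin n ; ∑-cong = pointwise n ; ∑-mono = mono n ; ∑-+ = distrib-+ n
  ; ∑-*ˡ = distrib-* n ; ∑<∑⇒∃< = find< n ; ∑≡0⇒≡0 = zero-terms n }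
  where
  pointwise : ∀ n {f g : Fin n → ℕ} → (∀ a → f a ≡ g a) → sumFin n f ≡ sumFin n g
  pointwise zero    eq = refl
  pointwise (suc n) eq = cong₂ _+_ (eq zero) (pointwise n (eq ∘ suc))

  mono : ∀ n {f g : Fin n → ℕ} → (∀ a → f a ≤ g a) → sumFin n f ≤ sumFin n g
  mono zero    le = z≤n
  mono (suc n) le = +-mono-≤ (le zero) (mono n (le ∘ suc))

  distrib-+ : ∀ n (f g : Fin n → ℕ) → sumFin n (λ a → f a + g a) ≡ sumFin n f + sumFin n g
  distrib-+ zero    f g = refl
  distrib-+ (suc n) f g rewrite distrib-+ n (f ∘ suc) (g ∘ suc) =
    +-interchange (f zero) (g zero) (sumFin n (f ∘ suc)) (sumFin n (g ∘ suc))
    where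
    +-interchange : ∀ a b c d → a + b + (c + d) ≡ a + c + (b + d)
    +-interchange = solve-∀

  distrib-* : ∀ n c (f : Fin n → ℕ) → sumFin n (λ a → c * f a) ≡ c * sumFin n f
  distrib-* zero    c f = sym (*-zeroʳ c)
  distrib-* (suc n) c f rewrite distrib-* n c (f ∘ suc) = sym (*-distribˡ-+ c (f zero) _)

  find< : ∀ n (f g : Fin n → ℕ) → sumFin n f < sumFin n g → ∃ λ a → f a < g a
  find< (suc n) f g lt with f zero <? g zero
  ... | yes p = zero , p
  ... | no ¬p with find< n (f ∘ suc) (g ∘ suc)
                     (+-cancelˡ-< (g zero) _ _ (≤-<-trans (+-monoˡ-≤ _ (≮⇒≥ ¬p)) lt))
  ... | a , q = suc a , q

  zero-terms : ∀ n (f : Fin n → ℕ) → sumFin n f ≡ 0 → ∀ a → f a ≡ 0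
  zero-terms (suc n) f eq zero    = m+n≡0⇒m≡0 (f zero) eq
  zero-terms (suc n) f eq (suc a) = zero-terms n (f ∘ suc) (m+n≡0⇒n≡0 (f zero) eq) a

module _ {A : Set} (SA : Summation A) where

  sumVec : ∀ n → (Vec A n → ℕ) → ℕ
  sumVec zero    h = h []
  sumVec (suc n) h = ∑ SA (λ a → sumVec n (λ v → h (a ∷ v)))

  vecSummation : ∀ n → Summation (Vec A n)
  vecSummation n = record
    { ∑ = sumVec n ; ∑-cong = pointwise n ; ∑-mono = mono n ; ∑-+ = distrib-+ n
    ; ∑-*ˡ = distrib-* n ; ∑<∑⇒∃< = find< n ; ∑≡0⇒≡0 = zero-terms n }
    where
    pointwise : ∀ n {f g : Vec A n → ℕ} → (∀ a → f a ≡ g a) → sumVec n f ≡ sumVec n g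
    pointwise zero    eq = eq []
    pointwise (suc n) eq = ∑-cong SA (λ a → pointwise n (λ v → eq (a ∷ v)))

    mono : ∀ n {f g : Vec A n → ℕ} → (∀ a → f a ≤ g a) → sumVec n f ≤ sumVec n g
    mono zero    le = le []
    mono (suc n) le = ∑-mono SA (λ a → mono n (λ v → le (a ∷ v)))

    distrib-+ : ∀ n (f g : Vec A n → ℕ) → sumVec n (λ a → f a + g a) ≡ sumVec n f + sumVec n g
    distrib-+ zero    f g = refl
    distrib-+ (suc n) f g =
      trans (∑-cong SA (λ a → distrib-+ n (λ v → f (a ∷ v)) (λ v → g (a ∷ v)))) (∑-+ SA _ _)

    distrib-* : ∀ n c (f : Vec A n → ℕ) → sumVec n (λ a → c * f a) ≡ c * sumVec n f
    distrib-* zero    c f = refl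
    distrib-* (suc n) c f = trans (∑-cong SA (λ a → distrib-* n c (λ v → f (a ∷ v)))) (∑-*ˡ SA c _)

    find< : ∀ n (f g : Vec A n → ℕ) → sumVec n f < sumVec n g → ∃ λ a → f a < g a
    find< zero    f g lt = [] , lt
    find< (suc n) f g lt with ∑<∑⇒∃< SA _ _ lt
    ... | a , p with find< n (λ v → f (a ∷ v)) (λ v → g (a ∷ v)) p
    ... | v , q = a ∷ v , q

    zero-terms : ∀ n (f : Vec A n → ℕ) → sumVec n f ≡ 0 → ∀ a → f a ≡ 0
    zero-terms zero    f eq []      = eq
    zero-terms (suc n) f eq (a ∷ v) = zero-terms n (λ w → f (a ∷ w)) (∑≡0⇒≡0 SA _ eq a) v

size-finSummation : ∀ n → size (finSummation n) ≡ n
size-finSummation zero    = refl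
size-finSummation (suc n) = cong suc (size-finSummation n)

size-vecSummation : ∀ {A} (SA : Summation A) n → size (vecSummation SA n) ≡ size SA ^ n
size-vecSummation SA zero    = refl
size-vecSummation SA (suc n) = begin
  ∑ SA (λ _ → sumVec SA n (λ _ → 1)) ≡⟨ ∑-const SA _ ⟩
  sumVec SA n (λ _ → 1) * size SA    ≡⟨ cong (_* size SA) (size-vecSummation SA n) ⟩
  size SA ^ n * size SA              ≡⟨ *-comm (size SA ^ n) _ ⟩
  size SA ^ suc n                    ∎
  where open ≡-Reasoning

size-vecFin : ∀ n m → size (vecSummation (finSummation n) m) ≡ n ^ m
size-vecFin n m = trans (size-vecSummation (finSummation n) m) (cong (_^ m) (size-finSummation n))

Fubini : ∀ {A C} → Summation A → Summation C → Set
Fubini {A} {C} SA SC = ∀ (h : A → C → ℕ) →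
  ∑ SA (λ a → ∑ SC (h a)) ≡ ∑ SC (λ c → ∑ SA (λ a → h a c))

fubini-Fin : ∀ {A} (SA : Summation A) n → Fubini SA (finSummation n)
fubini-Fin SA zero    h = ∑-0 SA
fubini-Fin SA (suc n) h =
  trans (∑-+ SA (λ a → h a zero) (λ a → sumFin n (λ j → h a (suc j))))
        (cong (∑ SA (λ a → h a zero) +_) (fubini-Fin SA n (λ a j → h a (suc j))))

fubini-Vec : ∀ {A C} (SA : Summation A) (SC : Summation C) → Fubini SA SC →
  ∀ n → Fubini SA (vecSummation SC n)
fubini-Vec SA SC fub zero    h = refl
fubini-Vec SA SC fub (suc n) h =
  trans (fub (λ a c → sumVec SC n (λ v → h a (c ∷ v))))
        (∑-cong SC (λ c → fubini-Vec SA SC fub n (λ a v → h a (c ∷ v))))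

∏ : ∀ n → (Fin n → ℕ) → ℕ
∏ zero    f = 1
∏ (suc n) f = f zero * ∏ n (f ∘ suc)

∏-cong : ∀ n {f g : Fin n → ℕ} → (∀ a → f a ≡ g a) → ∏ n f ≡ ∏ n g
∏-cong zero    eq = refl
∏-cong (suc n) eq = cong₂ _*_ (eq zero) (∏-cong n (eq ∘ suc))

∏-const : ∀ n c → ∏ n (λ _ → c) ≡ c ^ n
∏-const zero    c = refl
∏-const (suc n) c = cong (c *_) (∏-const n c)

∏≡0⇒∃≡0 : ∀ n (f : Fin n → ℕ) → ∏ n f ≡ 0 → ∃ λ a → f a ≡ 0
∏≡0⇒∃≡0 (suc n) f eq with m*n≡0⇒m≡0∨n≡0 (f zero) eq
... | inj₁ p = zero , p
... | inj₂ p with ∏≡0⇒∃≡0 n (f ∘ suc) p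
... | a , q = suc a , q

∑-∏ : ∀ {A} (SA : Summation A) n (h : Fin n → A → ℕ) →
  sumVec SA n (λ v → ∏ n (λ j → h j (lookup v j))) ≡ ∏ n (λ j → ∑ SA (h j))
∑-∏ SA zero    h = refl
∑-∏ SA (suc n) h = begin
  ∑ SA (λ a → sumVec SA n (λ v → h zero a * ∏ n (λ j → h (suc j) (lookup v j))))
    ≡⟨ ∑-cong SA (λ a → ∑-*ˡ (vecSummation SA n) (h zero a) _) ⟩
  ∑ SA (λ a → h zero a * sumVec SA n (λ v → ∏ n (λ j → h (suc j) (lookup v j))))
    ≡⟨ ∑-cong SA (λ a → cong (h zero a *_) (∑-∏ SA n (h ∘ suc))) ⟩
  ∑ SA (λ a → h zero a * ∏ n (λ j → ∑ SA (h (suc j))))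
    ≡⟨ ∑-*ʳ SA _ (h zero) ⟩
  ∑ SA (h zero) * ∏ n (λ j → ∑ SA (h (suc j)))
    ∎
  where open ≡-Reasoning

∏-exchange : ∀ n (f g : Fin n → ℕ) y → (∀ x → x ≢ y → f x ≡ g x) →
  ∏ n f * g y ≡ ∏ n g * f y
∏-exchange (suc n) f g zero agree
  rewrite ∏-cong n {f ∘ suc} {g ∘ suc} (λ a → agree (suc a) (λ ()))
  = swap-outer (f zero) (g zero) (∏ n (g ∘ suc))
  where
  swap-outer : ∀ a b c → a * c * b ≡ b * c * a
  swap-outer = solve-∀
∏-exchange (suc n) f g (suc y) agree rewrite agree zero (λ ()) = begin
  g zero * ∏ n (f ∘ suc) * g (suc y)   ≡⟨ *-assoc (g zero) _ _ ⟩
  g zero * (∏ n (f ∘ suc) * g (suc y)) ≡⟨ cong (g zero *_) (∏-exchange n (f ∘ suc) (g ∘ suc) y agree′) ⟩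
  g zero * (∏ n (g ∘ suc) * f (suc y)) ≡⟨ *-assoc (g zero) _ _ ⟨
  g zero * ∏ n (g ∘ suc) * f (suc y)   ∎
  where
  open ≡-Reasoning
  agree′ : ∀ x → x ≢ y → f (suc x) ≡ g (suc x)
  agree′ x x≢y = agree (suc x) (x≢y ∘ Finₚ.suc-injective)

⟦_⟧ : Bool → ℕ
⟦ true  ⟧ = 1
⟦ false ⟧ = 0

⟦⟧≡0⇒≡false : ∀ {c} → ⟦ c ⟧ ≡ 0 → c ≡ false
⟦⟧≡0⇒≡false {false} _ = refl

_∈ᵇ_ : ∀ {n m} → Fin n → Vec (Fin n) m → Bool
x ∈ᵇ []       = false
x ∈ᵇ (y ∷ ys) = does (x ≟ y) ∨ x ∈ᵇ ys

distinctᵇ : ∀ {n m} → Vec (Fin n) m → Bool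
distinctᵇ []       = true
distinctᵇ (y ∷ ys) = not (y ∈ᵇ ys) ∧ distinctᵇ ys

module _ {n m : ℕ} where

  ∈ᵇ-here : ∀ (y : Fin n) (ys : Vec (Fin n) m) → y ∈ᵇ (y ∷ ys) ≡ true
  ∈ᵇ-here y ys with y ≟ y
  ... | yes _   = refl
  ... | no y≢y = ⊥-elim (y≢y refl)

  ∈ᵇ-there : ∀ {x y : Fin n} (ys : Vec (Fin n) m) → x ≢ y → x ∈ᵇ (y ∷ ys) ≡ x ∈ᵇ ys
  ∈ᵇ-there {x} {y} ys x≢y with x ≟ y
  ... | yes x≡y = ⊥-elim (x≢y x≡y)
  ... | no _    = refl

  distinctᵇ-∷⁻ : ∀ (y : Fin n) (ys : Vec (Fin n) m) → distinctᵇ (y ∷ ys) ≡ true →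
    y ∈ᵇ ys ≡ false × distinctᵇ ys ≡ true
  distinctᵇ-∷⁻ y ys d with y ∈ᵇ ys | distinctᵇ ys
  ... | false | true = refl , refl

∑-⟦≟⟧ : ∀ n (t : Fin n) → sumFin n (λ y → ⟦ does (y ≟ t) ⟧) ≡ 1
∑-⟦≟⟧ (suc n) zero    = cong suc (∑-0 (finSummation n))
∑-⟦≟⟧ (suc n) (suc t) = trans (∑-cong (finSummation n) (λ y → cong ⟦_⟧ (suc≟suc y))) (∑-⟦≟⟧ n t)
  where
  suc≟suc : ∀ y → does (suc y ≟ suc t) ≡ does (y ≟ t)
  suc≟suc y with y ≟ t
  ... | yes refl = refl
  ... | no _     = refl

⟦∨⟧≤ : ∀ a b → ⟦ a ∨ b ⟧ ≤ ⟦ a ⟧ + ⟦ b ⟧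
⟦∨⟧≤ true  b = s≤s z≤n
⟦∨⟧≤ false b = ≤-refl

∑-⟦∈ᵇ⟧≤length : ∀ n {m} (ts : Vec (Fin n) m) → sumFin n (λ y → ⟦ y ∈ᵇ ts ⟧) ≤ m
∑-⟦∈ᵇ⟧≤length n []            = ≤-reflexive (∑-0 (finSummation n))
∑-⟦∈ᵇ⟧≤length n {suc m} (t ∷ ts) = begin
  sumFin n (λ y → ⟦ does (y ≟ t) ∨ y ∈ᵇ ts ⟧)
    ≤⟨ ∑-mono (finSummation n) (λ y → ⟦∨⟧≤ (does (y ≟ t)) (y ∈ᵇ ts)) ⟩
  sumFin n (λ y → ⟦ does (y ≟ t) ⟧ + ⟦ y ∈ᵇ ts ⟧)
    ≡⟨ ∑-+ (finSummation n) _ _ ⟩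
  sumFin n (λ y → ⟦ does (y ≟ t) ⟧) + sumFin n (λ y → ⟦ y ∈ᵇ ts ⟧)
    ≤⟨ +-mono-≤ (≤-reflexive (∑-⟦≟⟧ n t)) (∑-⟦∈ᵇ⟧≤length n ts) ⟩
  suc m ∎
  where open ≤-Reasoning

∏-if-∈ᵇ : ∀ N (a b : ℕ) {m} (xs : Vec (Fin N) m) → distinctᵇ xs ≡ true →
  ∏ N (λ x → if x ∈ᵇ xs then a else b) * b ^ m ≡ a ^ m * b ^ N
∏-if-∈ᵇ N a b []       _ = trans (*-identityʳ _) (trans (∏-const N b) (sym (+-identityʳ _)))
∏-if-∈ᵇ N a b {suc m} (y ∷ ys) d = begin
  ∏ N f′ * (b * b ^ m) ≡⟨ *-assoc (∏ N f′) b _ ⟨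
  ∏ N f′ * b * b ^ m   ≡⟨ cong (_* b ^ m) exchange ⟩
  ∏ N f * a * b ^ m    ≡⟨ cong (_* b ^ m) (*-comm (∏ N f) a) ⟩
  a * ∏ N f * b ^ m    ≡⟨ *-assoc a (∏ N f) _ ⟩
  a * (∏ N f * b ^ m)  ≡⟨ cong (a *_) (∏-if-∈ᵇ N a b ys (proj₂ (distinctᵇ-∷⁻ y ys d))) ⟩
  a * (a ^ m * b ^ N)  ≡⟨ *-assoc a _ _ ⟨
  a ^ suc m * b ^ N    ∎
  where
  open ≡-Reasoning
  f′ f : Fin N → ℕ
  f′ x = if x ∈ᵇ (y ∷ ys) then a else b
  f  x = if x ∈ᵇ ys then a else b
  exchange : ∏ N f′ * b ≡ ∏ N f * a
  exchange = begin
    ∏ N f′ * b   ≡⟨ cong (λ c → ∏ N f′ * (if c then a else b)) (proj₁ (distinctᵇ-∷⁻ y ys d)) ⟨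
    ∏ N f′ * f y ≡⟨ ∏-exchange N f′ f y (λ x x≢y → cong (if_then a else b) (∈ᵇ-there ys x≢y)) ⟩
    ∏ N f * f′ y ≡⟨ cong (λ c → ∏ N f * (if c then a else b)) (∈ᵇ-here y ys) ⟩
    ∏ N f * a    ∎

module _ {n : ℕ} where

  ∈ᵇ-fromList⁻ : ∀ {x : Fin n} (A : List (Fin n)) → x ∈ᵇ Vec.fromList A ≡ true → x ∈ A
  ∈ᵇ-fromList⁻ {x} (y ∷ A) x∈A with x ≟ y
  ... | yes x≡y = here x≡y
  ... | no _    = there (∈ᵇ-fromList⁻ A x∈A)

  ∉-fromList⇒∈ᵇ≡false : ∀ {x : Fin n} (A : List (Fin n)) → All (x ≢_) A → x ∈ᵇ Vec.fromList A ≡ false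
  ∉-fromList⇒∈ᵇ≡false []      []           = refl
  ∉-fromList⇒∈ᵇ≡false (y ∷ A) (x≢y ∷ x∉A) = trans (∈ᵇ-there (Vec.fromList A) x≢y) (∉-fromList⇒∈ᵇ≡false A x∉A)

  distinctᵇ-fromList : ∀ (A : List (Fin n)) → Unique A → distinctᵇ (Vec.fromList A) ≡ true
  distinctᵇ-fromList []      []           = refl
  distinctᵇ-fromList (y ∷ A) (y∉A ∷ uniq) rewrite ∉-fromList⇒∈ᵇ≡false A y∉A = distinctᵇ-fromList A uniq

  pad : Fin n → ∀ {m} (O : List (Fin n)) → length O ≤ m → Vec (Fin n) m
  pad d {m} []      _       = Vec.replicate m d
  pad d     (o ∷ O) (s≤s h) = o ∷ pad d O h

  ∈ᵇ-pad : ∀ d {m} {y : Fin n} (O : List (Fin n)) (h : length O ≤ m) → y ∈ O → y ∈ᵇ pad d O h ≡ true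
  ∈ᵇ-pad d         (o ∷ O) (s≤s h) (here refl) = ∈ᵇ-here o (pad d O h)
  ∈ᵇ-pad d {y = y} (o ∷ O) (s≤s h) (there y∈O) =
    trans (cong (does (y ≟ o) ∨_) (∈ᵇ-pad d O h y∈O)) (Boolₚ.∨-zeroʳ _)

-- Existence of a graph satisfying Hall's condition for small sets

^-distribʳ-* : ∀ m n o → (m * n) ^ o ≡ m ^ o * n ^ o
^-distribʳ-* m n zero    = refl
^-distribʳ-* m n (suc o) rewrite ^-distribʳ-* m n o = interchange m n (m ^ o) (n ^ o)
  where
  interchange : ∀ a b c d → a * b * (c * d) ≡ a * c * (b * d)
  interchange = solve-∀

m≤m^[1+n] : ∀ m n .{{_ : NonZero m}} → m ≤ m ^ suc n
m≤m^[1+n] m n = m≤m*n m (m ^ n) {{m^n≢0 m n}}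

m*2≤n⇒m<n : ∀ {m n} → 0 < n → m * 2 ≤ n → m < n
m*2≤n⇒m<n {zero}    0<n _     = 0<n
m*2≤n⇒m<n {suc m} _   m*2≤n = <-≤-trans (m<m*n (suc m) 2 (s≤s (s≤s z≤n))) m*2≤n

HallUpTo : ∀ {N D B} → (Fin N → Fin D → Fin B) → ℕ → Set
HallUpTo {N} {D} {B} g K = ∀ (A : List (Fin N)) (O : List (Fin B)) → Unique A → length A ≤ K →
  (∀ {x} → x ∈ A → ∀ i → g x i ∈ O) → length A ≤ length O

-- A graph of left degree D is encoded as a table in Vec (Vec (Fin B) D) N, and
-- expectations over a uniformly random graph become sums over all tables.
module RandomGraph (N B D K : ℕ) {{_ : NonZero N}} {{_ : NonZero B}} {{_ : NonZero K}}
                   (dense : N * B * (2 * K) * K ^ D ≤ B ^ D) where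

  Row Table : Set
  Row   = Vec (Fin B) D
  Table = Vec Row N

  rows : Summation Row
  rows = vecSummation (finSummation B) D

  tables : Summation Table
  tables = vecSummation rows N

  b : ℕ
  b = B ^ D

  instance
    b≢0 : NonZero b
    b≢0 = m^n≢0 B D

  neighbour : Table → Fin N → Fin D → Fin B
  neighbour w x i = lookup (lookup w x) i

  rowWithin : ∀ {m} → Vec (Fin B) m → Row → ℕ
  rowWithin ts u = ∏ D (λ i → ⟦ lookup u i ∈ᵇ ts ⟧)

  restrictedTo : ∀ {m m′} → Vec (Fin N) m → Vec (Fin B) m′ → Fin N → Row → ℕ
  restrictedTo xs ts x u = if x ∈ᵇ xs then rowWithin ts u else 1

  bad : ∀ {m m′} → Vec (Fin N) m → Vec (Fin B) m′ → Table → ℕ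
  bad xs ts w = ⟦ distinctᵇ xs ⟧ * ∏ N (λ x → restrictedTo xs ts x (lookup w x))

  ∑-rowWithin≤ : ∀ {m} (ts : Vec (Fin B) m) → m < K → ∑ rows (rowWithin ts) ≤ K ^ D
  ∑-rowWithin≤ ts m<K = begin
    ∑ rows (rowWithin ts)                    ≡⟨ ∑-∏ (finSummation B) D (λ _ y → ⟦ y ∈ᵇ ts ⟧) ⟩
    ∏ D (λ _ → sumFin B (λ y → ⟦ y ∈ᵇ ts ⟧)) ≡⟨ ∏-const D _ ⟩
    sumFin B (λ y → ⟦ y ∈ᵇ ts ⟧) ^ D         ≤⟨ ^-monoˡ-≤ D (≤-trans (∑-⟦∈ᵇ⟧≤length B ts) (<⇒≤ m<K)) ⟩
    K ^ D                                    ∎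
    where open ≤-Reasoning

  ∑-bad : ∀ {m m′} (xs : Vec (Fin N) m) (ts : Vec (Fin B) m′) → distinctᵇ xs ≡ true →
    ∑ tables (bad xs ts) ≡ ∏ N (λ x → if x ∈ᵇ xs then ∑ rows (rowWithin ts) else b)
  ∑-bad xs ts distinct = begin
    ∑ tables (bad xs ts)
      ≡⟨ ∑-cong tables (λ w → cong (λ d → ⟦ d ⟧ * ∏ N (λ x → restrictedTo xs ts x (lookup w x))) distinct) ⟩
    ∑ tables (λ w → 1 * ∏ N (λ x → restrictedTo xs ts x (lookup w x)))
      ≡⟨ ∑-cong tables (λ w → *-identityˡ _) ⟩
    ∑ tables (λ w → ∏ N (λ x → restrictedTo xs ts x (lookup w x)))
      ≡⟨ ∑-∏ rows N (restrictedTo xs ts) ⟩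
    ∏ N (λ x → ∑ rows (restrictedTo xs ts x))
      ≡⟨ ∏-cong N ∑-restrictedTo ⟩
    ∏ N (λ x → if x ∈ᵇ xs then ∑ rows (rowWithin ts) else b)
      ∎
    where
    open ≡-Reasoning
    ∑-restrictedTo : ∀ x → ∑ rows (restrictedTo xs ts x) ≡ (if x ∈ᵇ xs then ∑ rows (rowWithin ts) else b)
    ∑-restrictedTo x with x ∈ᵇ xs
    ... | true  = refl
    ... | false = size-vecFin B D

  dense-power : ∀ s a → a ≤ K ^ D → a ^ suc s * (N ^ suc s * B ^ s * (2 * K)) ≤ b ^ suc s
  dense-power s a a≤ = begin
    a ^ s+1 * (N ^ s+1 * B ^ s * (2 * K))
      ≤⟨ *-mono-≤ (^-monoˡ-≤ s+1 a≤) (*-mono-≤ (*-monoʳ-≤ (N ^ s+1) (m≤n*m (B ^ s) B)) (m≤m^[1+n] (2 * K) s {{m*n≢0 2 K}})) ⟩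
    (K ^ D) ^ s+1 * (N ^ s+1 * B ^ s+1 * (2 * K) ^ s+1)
      ≡⟨ *-comm ((K ^ D) ^ s+1) _ ⟩
    N ^ s+1 * B ^ s+1 * (2 * K) ^ s+1 * (K ^ D) ^ s+1
      ≡⟨ cong (λ z → z * (2 * K) ^ s+1 * (K ^ D) ^ s+1) (^-distribʳ-* N B s+1) ⟨
    (N * B) ^ s+1 * (2 * K) ^ s+1 * (K ^ D) ^ s+1
      ≡⟨ cong (_* (K ^ D) ^ s+1) (^-distribʳ-* (N * B) (2 * K) s+1) ⟨
    (N * B * (2 * K)) ^ s+1 * (K ^ D) ^ s+1
      ≡⟨ ^-distribʳ-* (N * B * (2 * K)) (K ^ D) s+1 ⟨
    (N * B * (2 * K) * K ^ D) ^ s+1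
      ≤⟨ ^-monoˡ-≤ s+1 dense ⟩
    b ^ s+1 ∎
    where
    open ≤-Reasoning
    s+1 : ℕ
    s+1 = suc s

  T : ℕ
  T = b ^ N

  size-tables : size tables ≡ T
  size-tables = trans (size-vecSummation rows N) (cong (_^ N) (size-vecFin B D))

  ∑-bad≡0 : ∀ {m m′} (xs : Vec (Fin N) m) (ts : Vec (Fin B) m′) → distinctᵇ xs ≡ false →
    ∑ tables (bad xs ts) ≡ 0
  ∑-bad≡0 xs ts nondistinct = trans
    (∑-cong tables (λ w → cong (λ d → ⟦ d ⟧ * ∏ N (λ x → restrictedTo xs ts x (lookup w x))) nondistinct))
    (∑-0 tables)

  bad-rare : ∀ {s} → s < K → (xs : Vec (Fin N) (suc s)) (ts : Vec (Fin B) s) →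
    ∑ tables (bad xs ts) * (N ^ suc s * B ^ s * (2 * K)) ≤ T
  bad-rare {s} s<K xs ts with distinctᵇ xs Boolₚ.≟ true
  ... | no nondistinct = ≤-trans (≤-reflexive (cong (_* _) (∑-bad≡0 xs ts (Boolₚ.¬-not nondistinct)))) z≤n
  ... | yes distinct   = *-cancelʳ-≤ _ _ (b ^ suc s) {{m^n≢0 b (suc s)}} (begin
    ∑ tables (bad xs ts) * c * b ^ suc s ≡⟨ cong (λ z → z * c * b ^ suc s) (∑-bad xs ts distinct) ⟩
    P * c * b ^ suc s                    ≡⟨ swap-last P c (b ^ suc s) ⟩
    P * b ^ suc s * c                    ≡⟨ cong (_* c) (∏-if-∈ᵇ N a b xs distinct) ⟩
    a ^ suc s * T * c                    ≡⟨ swap-first (a ^ suc s) T c ⟩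
    T * (a ^ suc s * c)                  ≤⟨ *-monoʳ-≤ T (dense-power s a (∑-rowWithin≤ ts s<K)) ⟩
    T * b ^ suc s                        ∎)
    where
    open ≤-Reasoning
    a c P : ℕ
    a = ∑ rows (rowWithin ts)
    c = N ^ suc s * B ^ s * (2 * K)
    P = ∏ N (λ x → if x ∈ᵇ xs then a else b)
    swap-last : ∀ p q r → p * q * r ≡ p * r * q
    swap-last = solve-∀
    swap-first : ∀ p q r → p * q * r ≡ q * (p * r)
    swap-first = solve-∀

  lefts : ∀ m → Summation (Vec (Fin N) m)
  lefts = vecSummation (finSummation N)

  rights : ∀ m → Summation (Vec (Fin B) m)
  rights = vecSummation (finSummation B)

  badOfSize : ℕ → Table → ℕ
  badOfSize s w = ∑ (lefts (suc s)) (λ xs → ∑ (rights s) (λ ts → bad xs ts w))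

  badCount : Table → ℕ
  badCount w = sumFin K (λ j → badOfSize (toℕ j) w)

  ∑-badOfSize≤ : ∀ {s} → s < K → ∑ tables (badOfSize s) * (2 * K) ≤ T
  ∑-badOfSize≤ {s} s<K = *-cancelʳ-≤ _ _ Q {{m*n≢0 (N ^ suc s) (B ^ s) {{m^n≢0 N (suc s)}} {{m^n≢0 B s}}}} (begin
    ∑ tables (badOfSize s) * (2 * K) * Q ≡⟨ rearrange (∑ tables (badOfSize s)) (2 * K) (N ^ suc s) (B ^ s) ⟩
    ∑ tables (badOfSize s) * c           ≡⟨ cong (_* c) exchange-sums ⟩
    ∑ (lefts (suc s)) (λ xs → ∑ (rights s) (λ ts → ∑ tables (bad xs ts))) * c
      ≤⟨ ∑-*≤ (lefts (suc s)) (λ xs → ∑ (rights s) (λ ts → ∑ tables (bad xs ts))) c (T * size (rights s))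
            (λ xs → ∑-*≤ (rights s) (λ ts → ∑ tables (bad xs ts)) c T (bad-rare s<K xs)) ⟩
    T * size (rights s) * size (lefts (suc s))
      ≡⟨ cong₂ (λ p q → T * p * q) (size-vecFin B s) (size-vecFin N (suc s)) ⟩
    T * B ^ s * N ^ suc s                ≡⟨ rearrange′ T (B ^ s) (N ^ suc s) ⟩
    T * Q                                ∎)
    where
    open ≤-Reasoning
    c Q : ℕ
    c = N ^ suc s * B ^ s * (2 * K)
    Q = N ^ suc s * B ^ s
    rearrange : ∀ x y p q → x * y * (p * q) ≡ x * (p * q * y)
    rearrange = solve-∀
    rearrange′ : ∀ x p q → x * p * q ≡ x * (q * p)
    rearrange′ = solve-∀
    exchange-sums : ∑ tables (badOfSize s) ≡ ∑ (lefts (suc s)) (λ xs → ∑ (rights s) (λ ts → ∑ tables (bad xs ts)))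
    exchange-sums =
      trans (fubini-Vec tables (finSummation N) (fubini-Fin tables N) (suc s) (λ w xs → ∑ (rights s) (λ ts → bad xs ts w)))
            (∑-cong (lefts (suc s)) (λ xs → fubini-Vec tables (finSummation B) (fubini-Fin tables B) s (λ w ts → bad xs ts w)))

  ∑-badCount≤ : ∑ tables badCount * 2 ≤ T
  ∑-badCount≤ = *-cancelʳ-≤ _ _ K (begin
    ∑ tables badCount * 2 * K                                ≡⟨ *-assoc (∑ tables badCount) 2 K ⟩
    ∑ tables badCount * (2 * K)                              ≡⟨ cong (_* (2 * K)) (fubini-Fin tables K _) ⟩
    sumFin K (λ j → ∑ tables (badOfSize (toℕ j))) * (2 * K)
      ≤⟨ ∑-*≤ (finSummation K) _ _ T (λ j → ∑-badOfSize≤ (Finₚ.toℕ<n j)) ⟩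
    T * size (finSummation K)                                ≡⟨ cong (T *_) (size-finSummation K) ⟩
    T * K                                                    ∎)
    where open ≤-Reasoning

  goodTable : ∃ λ w → badCount w ≡ 0
  goodTable with ∑<∑⇒∃< tables badCount (λ _ → 1) ∑-badCount<size
    where
    ∑-badCount<size : ∑ tables badCount < size tables
    ∑-badCount<size = subst (∑ tables badCount <_) (sym size-tables)
                        (m*2≤n⇒m<n (m^n>0 b N) ∑-badCount≤)
  ... | w , badCount<1 = w , n<1⇒n≡0 badCount<1

  restrictedTo≡0 : ∀ {m m′} (xs : Vec (Fin N) m) (ts : Vec (Fin B) m′) x u →
    restrictedTo xs ts x u ≡ 0 → x ∈ᵇ xs ≡ true × rowWithin ts u ≡ 0
  restrictedTo≡0 xs ts x u eq with x ∈ᵇ xs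
  ... | true = refl , eq

  bad≡0⇒escape : ∀ {m m′} w (xs : Vec (Fin N) m) (ts : Vec (Fin B) m′) →
    distinctᵇ xs ≡ true → bad xs ts w ≡ 0 →
    ∃ λ x → x ∈ᵇ xs ≡ true × ∃ λ i → neighbour w x i ∈ᵇ ts ≡ false
  bad≡0⇒escape w xs ts distinct bad≡0 =
    let x , restricted≡0 = ∏≡0⇒∃≡0 N _ product≡0
        x∈xs , row≡0     = restrictedTo≡0 xs ts x (lookup w x) restricted≡0
        i , entry≡0      = ∏≡0⇒∃≡0 D _ row≡0
    in  x , x∈xs , i , ⟦⟧≡0⇒≡false entry≡0
    where
    P : ℕ
    P = ∏ N (λ x → restrictedTo xs ts x (lookup w x))
    product≡0 : P ≡ 0
    product≡0 = trans (sym (*-identityˡ P)) (trans (cong (λ d → ⟦ d ⟧ * P) (sym distinct)) bad≡0)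

  badCount≡0⇒bad≡0 : ∀ w → badCount w ≡ 0 → ∀ {s} → s < K →
    (xs : Vec (Fin N) (suc s)) (ts : Vec (Fin B) s) → bad xs ts w ≡ 0
  badCount≡0⇒bad≡0 w count≡0 {s} s<K xs ts =
    ∑≡0⇒≡0 (rights s) (λ ts → bad xs ts w)
      (∑≡0⇒≡0 (lefts (suc s)) (λ xs → ∑ (rights s) (λ ts → bad xs ts w)) badOfSize≡0 xs) ts
    where
    badOfSize≡0 : badOfSize s w ≡ 0
    badOfSize≡0 = subst (λ r → badOfSize r w ≡ 0) (Finₚ.toℕ-fromℕ< s<K)
                        (∑≡0⇒≡0 (finSummation K) (λ j → badOfSize (toℕ j) w) count≡0 (fromℕ< s<K))

  hallGraph : Σ (Fin N → Fin D → Fin B) λ g → HallUpTo g K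
  hallGraph = neighbour w , hall
    where
    w : Table
    w = proj₁ goodTable

    hall : HallUpTo (neighbour w) K
    hall []      O _    _     _       = z≤n
    hall (y ∷ A) O uniq |A|<K covered = ≮⇒≥ λ |O|<|A| → escape (s≤s⁻¹ |O|<|A|)
      where
      escape : length O ≤ length A → ⊥
      escape |O|≤|A| =
        let x , x∈A , i , escapes = bad≡0⇒escape w xs ts (distinctᵇ-fromList (y ∷ A) uniq)
                                      (badCount≡0⇒bad≡0 w (proj₂ goodTable) |A|<K xs ts)
        in  contradiction (trans (sym (∈ᵇ-pad d O |O|≤|A| (covered (∈ᵇ-fromList⁻ (y ∷ A) x∈A) i))) escapes) λ ()
        where
        d : Fin B
        d = fromℕ< (>-nonZero⁻¹ B)
        xs : Vec (Fin N) (suc (length A))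
        xs = Vec.fromList (y ∷ A)
        ts : Vec (Fin B) (length A)
        ts = pad d O |O|≤|A|

-- The levelled greedy strategy

module LevelledGreedy
  {N D B L K R : ℕ} (g : Fin N → Fin D → Fin B) (hall : HallUpTo g K)
  (enc : Fin L → Fin B → Fin R)
  (enc-injective : ∀ {l y l′ y′} → enc l y ≡ enc l′ y′ → l ≡ l′ × y ≡ y′)
  (E : BipGraph N R) (levels⊆E : ∀ x l i → enc l (g x i) ∈ₛ E x)
  (K<2^L : K < 2 ^ L) where

  open import Data.List.Membership.DecPropositional (_≟_ {n = R}) using (_∈?_)

  record Entry : Set where
    constructor entry
    field
      element : Fin N
      level   : Fin L
      port    : Fin D
  open Entry

  lv : Entry → ℕ
  lv e = toℕ (level e)

  assignment : Entry → Fin N × Fin R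
  assignment e = element e , enc (level e) (g (element e) (port e))

  position : List Entry → List (Fin N × Fin R)
  position = map assignment

  presented : List Entry → List (Fin N)
  presented es = map proj₁ (position es)

  taken : List Entry → List (Fin R)
  taken es = map proj₂ (position es)

  LowerLevelsTaken : List (Fin R) → List Entry → Set
  LowerLevelsTaken ys = All (λ e → ∀ (l : Fin′ (level e)) i → enc (inject l) (g (element e) i) ∈ ys)

  atLeast : ℕ → List Entry → List (Fin N)
  atLeast m []       = []
  atLeast m (e ∷ es) with m ≤? lv e
  ... | yes _ = element e ∷ atLeast m es
  ... | no  _ = atLeast m es

  usedAt : ℕ → List Entry → List (Fin B)
  usedAt m []       = []
  usedAt m (e ∷ es) with m ≟ℕ lv e
  ... | yes _ = g (element e) (port e) ∷ usedAt m es
  ... | no  _ = usedAt m es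

  length-atLeast : ∀ m es → length (atLeast m es) ≡ length (usedAt m es) + length (atLeast (suc m) es)
  length-atLeast m []       = refl
  length-atLeast m (e ∷ es) with m ≤? lv e | m ≟ℕ lv e | suc m ≤? lv e
  ... | yes _   | yes refl | yes m<m = contradiction m<m (n≮n m)
  ... | yes _   | yes _    | no  _   = cong suc (length-atLeast m es)
  ... | yes _   | no  _    | yes _   = trans (cong suc (length-atLeast m es)) (sym (+-suc _ _))
  ... | yes m≤  | no  m≢   | no  m≮  = contradiction (≤∧≢⇒< m≤ m≢) m≮
  ... | no  m≰  | yes refl | _       = contradiction ≤-refl m≰
  ... | no  m≰  | no  _    | yes m<  = contradiction (<⇒≤ m<) m≰
  ... | no  _   | no  _    | no  _   = length-atLeast m es

  length-atLeast≤ : ∀ m es → length (atLeast m es) ≤ length es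
  length-atLeast≤ m []       = z≤n
  length-atLeast≤ m (e ∷ es) with m ≤? lv e
  ... | yes _ = s≤s (length-atLeast≤ m es)
  ... | no  _ = m≤n⇒m≤1+n (length-atLeast≤ m es)

  ∈-atLeast⁻ : ∀ m es {P : Fin N → Set} → All (λ e → m ≤ lv e → P (element e)) es →
    ∀ {z} → z ∈ atLeast m es → P z
  ∈-atLeast⁻ m (e ∷ es) (p ∷ ps) z∈ with m ≤? lv e
  ∈-atLeast⁻ m (e ∷ es) (p ∷ ps) (here refl) | yes m≤ = p m≤
  ∈-atLeast⁻ m (e ∷ es) (p ∷ ps) (there z∈)  | yes _  = ∈-atLeast⁻ m es ps z∈
  ∈-atLeast⁻ m (e ∷ es) (p ∷ ps) z∈          | no  _  = ∈-atLeast⁻ m es ps z∈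

  atLeast⊆presented : ∀ m es {z} → z ∈ atLeast m es → z ∈ presented es
  atLeast⊆presented m (e ∷ es) z∈ with m ≤? lv e
  atLeast⊆presented m (e ∷ es) (here refl) | yes _ = here refl
  atLeast⊆presented m (e ∷ es) (there z∈)  | yes _ = there (atLeast⊆presented m es z∈)
  atLeast⊆presented m (e ∷ es) z∈          | no  _ = there (atLeast⊆presented m es z∈)

  ∷-unique : ∀ {x : Fin N} {A} → x ∉ A → Unique A → Unique (x ∷ A)
  ∷-unique x∉A uniq = All.tabulate (λ z∈A x≡z → x∉A (subst (_∈ _) (sym x≡z) z∈A)) ∷ uniq

  atLeast-unique : ∀ m es → Unique (presented es) → Unique (atLeast m es)
  atLeast-unique m []       _            = []
  atLeast-unique m (e ∷ es) (e∉ ∷ uniq) with m ≤? lv e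
  ... | yes _ = All.tabulate (λ z∈ → All.lookup e∉ (atLeast⊆presented m es z∈)) ∷ atLeast-unique m es uniq
  ... | no  _ = atLeast-unique m es uniq

  taken⇒usedAt : ∀ {m l y} es → toℕ l ≡ m → enc l y ∈ taken es → y ∈ usedAt m es
  taken⇒usedAt {m} (e ∷ es) refl (here eq) with enc-injective eq
  ... | refl , refl with m ≟ℕ m
  ...   | yes _ = here refl
  ...   | no m≢m = contradiction refl m≢m
  taken⇒usedAt {m} (e ∷ es) l≡m (there y∈) with m ≟ℕ lv e
  ... | yes _ = there (taken⇒usedAt es l≡m y∈)
  ... | no  _ = taken⇒usedAt es l≡m y∈

  module AllTaken (es : List Entry) (lower : LowerLevelsTaken (taken es) es)
                  (uniq : Unique (presented es)) (|es|<K : length es < K)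
                  (x : Fin N) (x∉ : x ∉ presented es) (full : ∀ l i → enc l (g x i) ∈ taken es) where

    waiting : ℕ → List (Fin N)
    waiting m = x ∷ atLeast m es

    waiting-covered : ∀ {m} → m < L → ∀ {z} → z ∈ waiting (suc m) → ∀ i → g z i ∈ usedAt m es
    waiting-covered m<L (here refl) i = taken⇒usedAt es (Finₚ.toℕ-fromℕ< m<L) (full (fromℕ< m<L) i)
    waiting-covered {m} m<L (there z∈) =
      ∈-atLeast⁻ (suc m) es (All.map (λ {e} lowerₑ m<e i → taken⇒usedAt es (toℕ-level {e} m<e) (lowerₑ (fromℕ< m<e) i)) lower) z∈
      where
      toℕ-level : ∀ {e : Entry} (m<e : m < lv e) → toℕ (inject {i = level e} (fromℕ< m<e)) ≡ m
      toℕ-level m<e = trans (Finₚ.toℕ-inject (fromℕ< m<e)) (Finₚ.toℕ-fromℕ< m<e)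

    doubling : ∀ {m} → m < L → 2 * length (waiting (suc m)) ≤ length (waiting m)
    doubling {m} m<L = begin
      2 * length (waiting (suc m))                           ≡⟨ cong (length (waiting (suc m)) +_) (+-identityʳ _) ⟩
      length (waiting (suc m)) + length (waiting (suc m))    ≤⟨ +-monoʳ-≤ (length (waiting (suc m))) waiting≤used ⟩
      length (waiting (suc m)) + length (usedAt m es)        ≡⟨ cong suc (+-comm (length (atLeast (suc m) es)) _) ⟩
      suc (length (usedAt m es) + length (atLeast (suc m) es)) ≡⟨ cong suc (length-atLeast m es) ⟨
      length (waiting m)                                     ∎
      where
      open ≤-Reasoning
      waiting≤used : length (waiting (suc m)) ≤ length (usedAt m es)
      waiting≤used = hall (waiting (suc m)) (usedAt m es)
        (∷-unique (x∉ ∘ atLeast⊆presented (suc m) es) (atLeast-unique (suc m) es uniq))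
        (≤-trans (s≤s (length-atLeast≤ (suc m) es)) |es|<K) (waiting-covered m<L)

    exponential : ∀ d m → m + d ≡ L → 2 ^ d ≤ length (waiting m)
    exponential zero    m _   = s≤s z≤n
    exponential (suc d) m m+d = begin
      2 * 2 ^ d                    ≤⟨ *-monoʳ-≤ 2 (exponential d (suc m) (trans (sym (+-suc m d)) m+d)) ⟩
      2 * length (waiting (suc m)) ≤⟨ doubling m<L ⟩
      length (waiting m)           ∎
      where
      open ≤-Reasoning
      m<L : m < L
      m<L = subst (m <_) m+d (m<m+n m z<s)

    impossible : ⊥
    impossible = <-irrefl refl (begin-strict
      2 ^ L                       ≤⟨ exponential L 0 refl ⟩
      suc (length (atLeast 0 es)) ≤⟨ s≤s (length-atLeast≤ 0 es) ⟩
      suc (length es)             ≤⟨ |es|<K ⟩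
      K                           <⟨ K<2^L ⟩
      2 ^ L                       ∎)
      where open ≤-Reasoning

  win : ∀ s es → LowerLevelsTaken (taken es) es → Unique (presented es) → length es + s ≤ K →
    WinsFrom E s (position es)
  win zero    es _     _    _      = tt
  win (suc s) es lower uniq budget x x∉ with all? (λ l → all? (λ i → enc l (g x i) ∈? taken es))
  ... | yes full = ⊥-elim (AllTaken.impossible es lower uniq |es|<K x x∉ full)
    where
    |es|<K : length es < K
    |es|<K = ≤-trans (s≤s (m≤m+n (length es) s)) (subst (_≤ K) (+-suc (length es) s) budget)
  ... | no ¬full with ¬∀⟶∃¬-smallest L _ (λ l → all? (λ i → enc l (g x i) ∈? taken es)) ¬full
  ... | l , ¬fullₗ , lower-full with ¬∀⟶∃¬ D _ (λ i → enc l (g x i) ∈? taken es) ¬fullₗ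
  ... | i , free = enc l (g x i) , levels⊆E x l i , free , win s (entry x l i ∷ es) lower′ uniq′ budget′
    where
    lower′ : LowerLevelsTaken (taken (entry x l i ∷ es)) (entry x l i ∷ es)
    lower′ = (λ l′ i′ → there (lower-full l′ i′)) ∷ All.map (λ lowerₑ l′ i′ → there (lowerₑ l′ i′)) lower
    uniq′ : Unique (presented (entry x l i ∷ es))
    uniq′ = ∷-unique x∉ uniq
    budget′ : length (entry x l i ∷ es) + s ≤ K
    budget′ = subst (_≤ K) (+-suc (length es) s) budget

  onlineMatchable : OnlineMatchable E K
  onlineMatchable = win K [] [] [] ≤-refl

∣p∪q∣≤∣p∣+∣q∣ : ∀ {n} (p q : Subset n) → ∣ p ∪ q ∣ ≤ ∣ p ∣ + ∣ q ∣
∣p∪q∣≤∣p∣+∣q∣ []          []          = z≤n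
∣p∪q∣≤∣p∣+∣q∣ (true ∷ p)  (true ∷ q)  = s≤s (≤-trans (∣p∪q∣≤∣p∣+∣q∣ p q) (+-monoʳ-≤ ∣ p ∣ (n≤1+n _)))
∣p∪q∣≤∣p∣+∣q∣ (true ∷ p)  (false ∷ q) = s≤s (∣p∪q∣≤∣p∣+∣q∣ p q)
∣p∪q∣≤∣p∣+∣q∣ (false ∷ p) (true ∷ q)  = subst (suc ∣ p ∪ q ∣ ≤_) (sym (+-suc ∣ p ∣ ∣ q ∣)) (s≤s (∣p∪q∣≤∣p∣+∣q∣ p q))
∣p∪q∣≤∣p∣+∣q∣ (false ∷ p) (false ∷ q) = ∣p∪q∣≤∣p∣+∣q∣ p q

image : ∀ {m n} → (Fin m → Fin n) → Subset n
image {zero}  f = ∅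
image {suc m} f = ⁅ f zero ⁆ ∪ image (f ∘ suc)

∣image∣≤ : ∀ {m n} (f : Fin m → Fin n) → ∣ image f ∣ ≤ m
∣image∣≤ {zero}  {n} f = ≤-reflexive (∣⊥∣≡0 n)
∣image∣≤ {suc m}     f = begin
  ∣ ⁅ f zero ⁆ ∪ image (f ∘ suc) ∣       ≤⟨ ∣p∪q∣≤∣p∣+∣q∣ ⁅ f zero ⁆ (image (f ∘ suc)) ⟩
  ∣ ⁅ f zero ⁆ ∣ + ∣ image (f ∘ suc) ∣   ≡⟨ cong (_+ ∣ image (f ∘ suc) ∣) (∣⁅x⁆∣≡1 (f zero)) ⟩
  suc ∣ image (f ∘ suc) ∣                ≤⟨ s≤s (∣image∣≤ (f ∘ suc)) ⟩
  suc m                                  ∎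
  where open ≤-Reasoning

∈-image : ∀ {m n} (f : Fin m → Fin n) a → f a ∈ₛ image f
∈-image f zero    = x∈p∪q⁺ (inj₁ (x∈⁅x⁆ (f zero)))
∈-image f (suc a) = x∈p∪q⁺ {p = ⁅ f zero ⁆} (inj₂ (∈-image (f ∘ suc) a))

diagonal-wins : ∀ {a} s (M : List (Fin a × Fin a)) → map proj₂ M ≡ map proj₁ M →
  WinsFrom (λ x → ⁅ x ⁆) s M
diagonal-wins zero    M _  = tt
diagonal-wins (suc s) M eq x x∉ =
  x , x∈⁅x⁆ x , subst (x ∉_) (sym eq) x∉ , diagonal-wins s ((x , x) ∷ M) (cong (x ∷_) eq)

2*[1+n]²≤n^5 : ∀ n → 2 ≤ n → 2 * (suc n * suc n) ≤ n ^ 5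
2*[1+n]²≤n^5 (suc zero)    (s≤s ())
2*[1+n]²≤n^5 (suc (suc m)) _ = begin
  2 * ((3 + m) * (3 + m))                   ≤⟨ m≤m+n _ _ ⟩
  2 * ((3 + m) * (3 + m)) + remainder       ≡⟨ expand m ⟩
  (2 + m) ^ 5                               ∎
  where
  open ≤-Reasoning
  remainder : ℕ
  remainder = m * m * m * m * m + 10 * (m * m * m * m) + 40 * (m * m * m) + 78 * (m * m) + 68 * m + 14
  expand : ∀ a → 2 * ((3 + a) * (3 + a)) +
                   (a * a * a * a * a + 10 * (a * a * a * a) + 40 * (a * a * a) + 78 * (a * a) + 68 * a + 14)
                 ≡ (2 + a) * ((2 + a) * ((2 + a) * ((2 + a) * ((2 + a) * 1))))
  expand = solve-∀

exponent≤ : ∀ n k → k ≤ n → n + (k + 2) + suc k + k * (2 * n + 2) ≤ (k + 2) * (2 * n + 2)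
exponent≤ n k k≤n = begin
  n + (k + 2) + suc k + k * (2 * n + 2) ≡⟨ collect n k ⟩
  n + 2 * k + 3 + k * (2 * n + 2)       ≤⟨ +-monoˡ-≤ (k * (2 * n + 2)) (+-monoˡ-≤ 3 (+-monoʳ-≤ n (*-monoʳ-≤ 2 k≤n))) ⟩
  n + 2 * n + 3 + k * (2 * n + 2)       ≤⟨ +-monoˡ-≤ (k * (2 * n + 2)) (m≤m+n (n + 2 * n + 3) (suc n)) ⟩
  n + 2 * n + 3 + suc n + k * (2 * n + 2) ≡⟨ factor n k ⟩
  (k + 2) * (2 * n + 2)                 ∎
  where
  open ≤-Reasoning
  collect : ∀ n k → n + (k + 2) + suc k + k * (2 * n + 2) ≡ n + 2 * k + 3 + k * (2 * n + 2)
  collect = solve-∀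
  factor : ∀ n k → n + 2 * n + 3 + suc n + k * (2 * n + 2) ≡ (k + 2) * (2 * n + 2)
  factor = solve-∀

dense : ∀ n k → k ≤ n →
  2 ^ n * 2 ^ (k + 2) * (2 * 2 ^ k) * (2 ^ k) ^ (2 * n + 2) ≤ (2 ^ (k + 2)) ^ (2 * n + 2)
dense n k k≤n = begin
  2 ^ n * 2 ^ (k + 2) * (2 * 2 ^ k) * (2 ^ k) ^ D
    ≡⟨ cong₂ (λ u v → u * (2 * 2 ^ k) * v) (^-distribˡ-+-* 2 n (k + 2)) (sym (^-*-assoc 2 k D)) ⟨
  2 ^ (n + (k + 2)) * 2 ^ suc k * 2 ^ (k * D)
    ≡⟨ cong (_* 2 ^ (k * D)) (^-distribˡ-+-* 2 (n + (k + 2)) (suc k)) ⟨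
  2 ^ (n + (k + 2) + suc k) * 2 ^ (k * D)
    ≡⟨ ^-distribˡ-+-* 2 (n + (k + 2) + suc k) (k * D) ⟨
  2 ^ (n + (k + 2) + suc k + k * D)
    ≤⟨ ^-monoʳ-≤ 2 (exponent≤ n k k≤n) ⟩
  2 ^ ((k + 2) * D)
    ≡⟨ ^-*-assoc 2 (k + 2) D ⟨
  (2 ^ (k + 2)) ^ D ∎
  where
  open ≤-Reasoning
  D : ℕ
  D = 2 * n + 2

levelledMatching : ∀ n k → 2 ≤ n → k ≤ n →
  Σ (BipGraph (2 ^ n) (2 ^ k * n ^ 5)) λ E →
    ((x : Fin (2 ^ n)) → ∣ E x ∣ ≤ n ^ 5) × OnlineMatchable E (2 ^ k)
levelledMatching n k 2≤n k≤n = E , degree≤ ,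
  LevelledGreedy.onlineMatchable g hall enc enc-injective E levels⊆E K<2^L
  where
  D L B : ℕ
  D = 2 * n + 2
  L = suc k
  B = 2 ^ (k + 2)

  graph : Σ (Fin (2 ^ n) → Fin D → Fin B) λ g → HallUpTo g (2 ^ k)
  graph = RandomGraph.hallGraph (2 ^ n) B D (2 ^ k) {{m^n≢0 2 n}} {{m^n≢0 2 (k + 2)}} {{m^n≢0 2 k}} (dense n k k≤n)
  g : Fin (2 ^ n) → Fin D → Fin B
  g = proj₁ graph

  hall : HallUpTo g (2 ^ k)
  hall = proj₂ graph

  L*D≤n^5 : L * D ≤ n ^ 5
  L*D≤n^5 = begin
    suc k * (2 * n + 2)   ≤⟨ *-monoˡ-≤ (2 * n + 2) (s≤s k≤n) ⟩
    suc n * (2 * n + 2)   ≡⟨ double-square n ⟩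
    2 * (suc n * suc n)   ≤⟨ 2*[1+n]²≤n^5 n 2≤n ⟩
    n ^ 5                 ∎
    where
    open ≤-Reasoning
    double-square : ∀ n → suc n * (2 * n + 2) ≡ 2 * (suc n * suc n)
    double-square = solve-∀

  L*B≤R : L * B ≤ 2 ^ k * n ^ 5
  L*B≤R = begin
    L * 2 ^ (k + 2)   ≡⟨ cong (L *_) (^-distribˡ-+-* 2 k 2) ⟩
    L * (2 ^ k * 4)   ≡⟨ rearrange L (2 ^ k) ⟩
    2 ^ k * (L * 4)   ≤⟨ *-monoʳ-≤ (2 ^ k) (≤-trans (*-monoʳ-≤ L 4≤D) L*D≤n^5) ⟩
    2 ^ k * n ^ 5     ∎
    where
    open ≤-Reasoning
    rearrange : ∀ a b → a * (b * 4) ≡ b * (a * 4)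
    rearrange = solve-∀
    4≤D : 4 ≤ D
    4≤D = ≤-trans (*-monoʳ-≤ 2 2≤n) (m≤m+n (2 * n) 2)

  enc : Fin L → Fin B → Fin (2 ^ k * n ^ 5)
  enc l y = inject≤ (combine l y) L*B≤R

  enc-injective : ∀ {l y l′ y′} → enc l y ≡ enc l′ y′ → l ≡ l′ × y ≡ y′
  enc-injective eq = Finₚ.combine-injective _ _ _ _ (Finₚ.inject≤-injective L*B≤R L*B≤R _ _ eq)

  neighbourAt : Fin (2 ^ n) → Fin L × Fin D → Fin (2 ^ k * n ^ 5)
  neighbourAt x (l , i) = enc l (g x i)

  E : BipGraph (2 ^ n) (2 ^ k * n ^ 5)
  E x = image (neighbourAt x ∘ remQuot D)

  degree≤ : (x : Fin (2 ^ n)) → ∣ E x ∣ ≤ n ^ 5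
  degree≤ x = ≤-trans (∣image∣≤ (neighbourAt x ∘ remQuot D)) L*D≤n^5

  levels⊆E : ∀ x l i → enc l (g x i) ∈ₛ E x
  levels⊆E x l i = subst (λ p → neighbourAt x p ∈ₛ E x) (Finₚ.remQuot-combine l i)
                         (∈-image (neighbourAt x ∘ remQuot D) (combine l i))

  K<2^L : 2 ^ k < 2 ^ L
  K<2^L = ^-monoʳ-< 2 (s≤s (s≤s z≤n)) (n<1+n k)

mainTheorem1 : Σ ℕ λ c → (n k : ℕ) → 1 ≤ n → k ≤ n →
    Σ (BipGraph (2 ^ n) (2 ^ k * n ^ c)) λ E →
      ((x : Fin (2 ^ n)) → ∣ E x ∣ ≤ n ^ c) × OnlineMatchable E (2 ^ k)
mainTheorem1 = 5 , λ where
  1 0 _ _ → (λ _ → ⁅ zero ⁆) , (λ _ → ≤-refl) ,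
            (λ _ _ → zero , x∈⁅x⁆ zero , (λ ()) , tt)
  1 1 _ _ → (λ x → ⁅ x ⁆) , (λ x → ≤-reflexive (∣⁅x⁆∣≡1 x)) , diagonal-wins 2 [] refl
  1 (suc (suc _)) _ (s≤s ())
  (suc (suc m)) k _ k≤n → levelledMatching (suc (suc m)) k (s≤s (s≤s z≤n)) k≤n
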